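{- Let $G=(V,E)$ be a computation graph with vertices $v_1,\dots,v_n$ and fast-memory size $M$. Let $\tilde L$ be the Laplacian of the weighted undirected graph $\tilde G$ obtained from $G$ by replacing each directed edge $(u,v)$ by an undirected edge of weight $1/d_{out}(u)$. For each integer $1\le k\le n$ let $W^{(k)}$ be the $n\times n$ matrix defined below. Then $J^*_G$ is lower bounded by the optimal value of $$\min_{X\in\mathcal{O}_G}\ \max_{1\le k\le n}\ \operatorname{tr}\!\left(X^T\tilde{L}XW^{(k)}\right) - 2 k M .$$
   Context: A computation graph is a finite directed acyclic graph $G=(V,E)$: each vertex is an operation producing a single element, and an edge $(u,v)$ means $u$ is an operand of $v$. Memory model: a single processor with fast memory holding at most $M$ elements and unbounded slow memory; each vertex is evaluated exactly once in a topological ordering of $G$; evaluating a vertex requires all its parents to be in fast memory and places its result in fast memory; eviction is unconstrained, but a value evicted while still needed later must first be written to slow memory. One I/O is counted per element written from fast to slow memory or read from slow to fast memory; inputs enter fast memory at no cost and outputs are reported at no cost. $J_G(X)$ is the number of I/Os for evaluation order $X$ and $J_G^*$ is its minimum over all valid orders. $d_{out}(u)$ is the out-degree of $u$ in $G$. The weighted Laplacian is $\tilde L=\tilde D-\tilde A$, where $\tilde A$ is the weighted adjacency matrix of $\tilde G$ and $\tilde D$ the diagonal matrix of weighted degrees. An evaluation order is encoded as an $n\times n$ permutation matrix $X$ with $X_{ij}=1$ iff vertex $v_i$ is evaluated at time-step $j$; $\mathcal{O}_G$ is the set of such matrices corresponding to topological orderings of $G$. For $1\le k\le n$, split the time-steps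 $1,\dots,n$ into $k$ consecutive blocks $B_1,\dots,B_k$, where the first $n \bmod k$ blocks have $\lfloor n/k\rfloor+1$ elements and the others $\lfloor n/k\rfloor$; let $\hat W^{(k)}\in\mathbb{R}^{n\times k}$ with $\hat W^{(k)}_{ij}=1$ if $i\in B_j$ and $0$ otherwise, and $W^{(k)}=\hat W^{(k)}(\hat W^{(k)})^T$. -}

module Defs where

open import Data.Bool using (Bool; true; false; if_then_else_; _∨_)
open import Data.Nat as ℕ using (ℕ; zero; suc; _/_; _%_; _⊓_)
open import Data.Fin using (Fin; toℕ; _≟_)
import Data.Fin
open import Data.List using (List; []; _∷_; foldr; map)
open import Data.List using (length; filter)
open import Data.Fin.Base using ()
open import Data.Integer using (+_)
open import Data.Rational using (ℚ; 0ℚ; 1ℚ; _+_; _*_; _-_; _≤_)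
import Data.Rational as Q
open import Data.Product using (Σ; ∃; _×_; _,_)
open import Relation.Binary.PropositionalEquality using (_≡_)
open import Relation.Nullary using (¬_; yes; no)
open import Relation.Nullary.Decidable using (⌊_⌋)
import Data.List as L

allFinL : (n : ℕ) → List (Fin n)
allFinL n = L.allFin n

Σℚ : {n : ℕ} → (Fin n → ℚ) → ℚ
Σℚ {n} f = foldr (λ i acc → f i + acc) 0ℚ (allFinL n)

count : {n : ℕ} → (Fin n → Bool) → ℕ
count {n} p = length (L.filter (λ i → p i B.≟ true) (allFinL n))
  where import Data.Bool.Properties as B

ℕ→ℚ : ℕ → ℚ
ℕ→ℚ m = + m Q./ 1

Mat : ℕ → ℕ → Set
Mat m p = Fin m → Fin p → ℚ

_ᵀ : {m p : ℕ} → Mat m p → Mat p m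
(A ᵀ) i j = A j i

_⊗_ : {m p q : ℕ} → Mat m p → Mat p q → Mat m q
(A ⊗ B) i j = Σℚ (λ l → A i l * B l j)

tr : {n : ℕ} → Mat n n → ℚ
tr A = Σℚ (λ i → A i i)

-- Computation graphs: vertices Fin n, edge (u , v) iff E u v ≡ true
-- (u is an operand of v).

Graph : ℕ → Set
Graph n = Fin n → Fin n → Bool

data Path {n : ℕ} (E : Graph n) : Fin n → Fin n → Set where
  edge : ∀ {u v} → E u v ≡ true → Path E u v
  step : ∀ {u v w} → E u v ≡ true → Path E v w → Path E u w

Acyclic : {n : ℕ} → Graph n → Set
Acyclic {n} E = (v : Fin n) → ¬ Path E v v

dout : {n : ℕ} → Graph n → Fin n → ℕ
dout E u = count (E u)

wdir : {n : ℕ} → Graph n → Fin n → Fin n → ℚ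
wdir E u v with E u v | dout E u
... | false | _ = 0ℚ
... | true | zero = 0ℚ   -- impossible: u has an out-edge
... | true | suc d = + 1 Q./ suc d

Ã : {n : ℕ} → Graph n → Mat n n
Ã E i j = wdir E i j + wdir E j i

D̃ : {n : ℕ} → Graph n → Mat n n
D̃ E i j with i ≟ j
... | yes _ = Σℚ (λ l → Ã E i l)
... | no _ = 0ℚ

L̃ : {n : ℕ} → Graph n → Mat n n
L̃ E i j = D̃ E i j - Ã E i j

record TopOrder {n : ℕ} (E : Graph n) : Set where
  field
    vertexAt : Fin n → Fin n
    timeOf   : Fin n → Fin n
    inv₁     : ∀ t → timeOf (vertexAt t) ≡ t
    inv₂     : ∀ v → vertexAt (timeOf v) ≡ v
    topo     : ∀ u v → E u v ≡ true → toℕ (timeOf u) ℕ.< toℕ (timeOf v)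

permMat : {n : ℕ} {E : Graph n} → TopOrder E → Mat n n
permMat σ i j with TopOrder.timeOf σ i ≟ j
... | yes _ = 1ℚ
... | no _ = 0ℚ

-- Block matrices W^(k), k = suc k' (so 1 ≤ k).  Time-steps are indexed
-- 0..n-1; block j (0-indexed) is [start j , start (j+1)) where
-- start j = j * ⌊n/k⌋ + min(j , n mod k): the first n mod k blocks have
-- ⌊n/k⌋+1 elements, the others ⌊n/k⌋.

blockStart : (n k' : ℕ) → ℕ → ℕ
blockStart n k' j = j ℕ.* (n / suc k') ℕ.+ (j ⊓ (n % suc k'))

Ŵ : (n k' : ℕ) → Mat n (suc k')
Ŵ n k' i j with blockStart n k' (toℕ j) ℕ.≤? toℕ i | toℕ i ℕ.<? blockStart n k' (suc (toℕ j))
... | yes _ | yes _ = 1ℚ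
... | _ | _ = 0ℚ

W : (n k' : ℕ) → Mat n n
W n k' = Ŵ n k' ⊗ (Ŵ n k' ᵀ)

objective : {n : ℕ} (E : Graph n) (M : ℕ) → TopOrder E → ℕ → ℚ
objective {n} E M σ k' =
  tr ((((permMat σ ᵀ) ⊗ L̃ E) ⊗ permMat σ) ⊗ W n k') - ℕ→ℚ (2 ℕ.* suc k' ℕ.* M)

IsMaxObj : {n : ℕ} (E : Graph n) (M : ℕ) → TopOrder E → ℚ → Set
IsMaxObj {n} E M σ m =
  (Σ ℕ λ k' → (suc k' ℕ.≤ n) × (objective E M σ k' ≡ m))
  × (∀ k' → suc k' ℕ.≤ n → objective E M σ k' ≤ m)

IsMinMax : {n : ℕ} (E : Graph n) (M : ℕ) → ℚ → Set
IsMinMax E M v =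
  (Σ (TopOrder E) λ σ → IsMaxObj E M σ v)
  × (∀ (σ : TopOrder E) m → IsMaxObj E M σ m → v ≤ m)

-- The I/O model.  State: fast memory, slow memory (as subsets of vertices)
-- and the number t of vertices evaluated so far.

set : {n : ℕ} → (Fin n → Bool) → Fin n → Bool → Fin n → Bool
set S v b u with u ≟ v
... | yes _ = b
... | no _ = S u

record MState (n : ℕ) : Set where
  constructor ⟨_,_,_⟩
  field
    fast : Fin n → Bool
    slow : Fin n → Bool
    done : ℕ

data Step {n : ℕ} (E : Graph n) (M : ℕ) (σ : TopOrder E)
     : MState n → MState n → ℕ → Set where
  -- evaluate the next vertex of the order: parents must be in fast memory,
  -- result placed in fast memory (no cost; inputs enter this way for free)
  compute : ∀ {F S} t → (tn : t ℕ.< n) →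
    let v = TopOrder.vertexAt σ (Data.Fin.fromℕ< tn) in
    (∀ u → E u v ≡ true → F u ≡ true) →
    count (set F v true) ℕ.≤ M →
    Step E M σ ⟨ F , S , t ⟩ ⟨ set F v true , S , suc t ⟩ 0
  store : ∀ {F S t} v → F v ≡ true →
    Step E M σ ⟨ F , S , t ⟩ ⟨ F , set S v true , t ⟩ 1
  load : ∀ {F S t} v → S v ≡ true → count (set F v true) ℕ.≤ M →
    Step E M σ ⟨ F , S , t ⟩ ⟨ set F v true , S , t ⟩ 1
  -- evict a value from fast memory (free; if not in slow memory it is lost)
  evict : ∀ {F S t} v →
    Step E M σ ⟨ F , S , t ⟩ ⟨ set F v false , S , t ⟩ 0

data Run {n : ℕ} (E : Graph n) (M : ℕ) (σ : TopOrder E)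
     : MState n → MState n → ℕ → Set where
  []  : ∀ {s} → Run E M σ s s 0
  _∷_ : ∀ {s s′ s″ c c′} → Step E M σ s s′ c → Run E M σ s′ s″ c′ →
        Run E M σ s s″ (c ℕ.+ c′)

initState : (n : ℕ) → MState n
initState n = ⟨ (λ _ → false) , (λ _ → false) , 0 ⟩

-- a complete evaluation of G in order σ using c I/Os (outputs free)
Evaluation : {n : ℕ} (E : Graph n) (M : ℕ) (σ : TopOrder E) (c : ℕ) → Set
Evaluation {n} E M σ c =
  Σ (Fin n → Bool) λ F → Σ (Fin n → Bool) λ S →
    Run E M σ (initState n) ⟨ F , S , n ⟩ c

IsOptimalIO : {n : ℕ} (E : Graph n) (M : ℕ) → ℕ → Set
IsOptimalIO E M j =
  (Σ (TopOrder E) λ σ → Evaluation E M σ j)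
  × (∀ (σ : TopOrder E) c → Evaluation E M σ c → j ℕ.≤ c)

-- Fix a topological order, with permutation matrix X, and a number k of blocks.  W⁽ᵏ⁾ is the
-- 0/1 matrix of "same block" pairs of time-steps, so tr(XᵀL̃XW⁽ᵏ⁾) sums L̃ over pairs of vertices
-- evaluated in the same block; as L̃ has zero row sums, this is the total weight of the edges of
-- G̃ joining different blocks.  The out-edges of a vertex carry weight at most 1 in total, so the
-- trace is at most 2C, where C counts the vertices with an edge into a later block.  Each of them
-- must outlive the end of its block: it is either in fast memory at that boundary (at most M
-- vertices at each of the k boundaries) or written to and later read back from slow memory.
-- An amortised (potential) argument turns this into 2C ≤ c + 2kM for every schedule of the order
-- with c I/Os.  Hence every objective value of an optimal order is at most J*_G, and so is the
-- min-max value.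

module Submission where

open import Defs
open import Data.Bool using (true)
open import Data.Fin using (Fin; toℕ)
open import Data.Nat as ℕ using (ℕ; zero; suc)
open import Relation.Binary.PropositionalEquality using (_≡_; _≢_)

module Rationals where

  open import Data.Nat as ℕ using (ℕ; zero; suc; _∸_)
  import Data.Nat.Properties as ℕ
  import Data.Integer as ℤ
  import Data.Integer.Properties as ℤ
  open import Data.Rational using (ℚ; mkℚ; 0ℚ; 1ℚ; _+_; _-_; -_; _*_; _≤_; _/_; _⊔_)
  open import Data.Rational.Properties
  open import Data.Rational.Solver using (module +-*-Solver)
  import Data.Nat.Coprimality as Coprime
  open import Data.Product using (Σ-syntax; _×_; _,_)
  open import Data.Sum using (inj₁; inj₂)
  open import Relation.Binary.PropositionalEquality

  private
    ℕ→ℚ≡mkℚ : ∀ m → ℕ→ℚ m ≡ mkℚ (ℤ.+ m) 0 (Coprime.sym (Coprime.1-coprimeTo m))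
    ℕ→ℚ≡mkℚ m = ↥p/↧p≡p (mkℚ (ℤ.+ m) 0 (Coprime.sym (Coprime.1-coprimeTo m)))

  ℕ→ℚ-suc : ∀ m → ℕ→ℚ (suc m) ≡ 1ℚ + ℕ→ℚ m
  ℕ→ℚ-suc m rewrite ℕ→ℚ≡mkℚ m = /-cong (cong (λ x → ℤ.+ 1 ℤ.+ x) (sym (ℤ.*-identityʳ (ℤ.+ m)))) refl

  ℕ→ℚ-+ : ∀ a b → ℕ→ℚ (a ℕ.+ b) ≡ ℕ→ℚ a + ℕ→ℚ b
  ℕ→ℚ-+ zero    b = sym (+-identityˡ (ℕ→ℚ b))
  ℕ→ℚ-+ (suc a) b = begin
    ℕ→ℚ (suc (a ℕ.+ b))       ≡⟨ ℕ→ℚ-suc (a ℕ.+ b) ⟩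
    1ℚ + ℕ→ℚ (a ℕ.+ b)        ≡⟨ cong (1ℚ +_) (ℕ→ℚ-+ a b) ⟩
    1ℚ + (ℕ→ℚ a + ℕ→ℚ b)      ≡⟨ +-assoc 1ℚ (ℕ→ℚ a) (ℕ→ℚ b) ⟨
    1ℚ + ℕ→ℚ a + ℕ→ℚ b        ≡⟨ cong (_+ ℕ→ℚ b) (ℕ→ℚ-suc a) ⟨
    ℕ→ℚ (suc a) + ℕ→ℚ b       ∎
    where open ≡-Reasoning

  ℕ→ℚ-mono-≤ : ∀ {a b} → a ℕ.≤ b → ℕ→ℚ a ≤ ℕ→ℚ b
  ℕ→ℚ-mono-≤ {a} {b} a≤b = begin
    ℕ→ℚ a                    ≡⟨ +-identityʳ (ℕ→ℚ a) ⟨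
    ℕ→ℚ a + 0ℚ               ≤⟨ +-monoʳ-≤ (ℕ→ℚ a) (nonNegative⁻¹ _ {{normalize-nonNeg (b ∸ a) 1}}) ⟩
    ℕ→ℚ a + ℕ→ℚ (b ∸ a)      ≡⟨ ℕ→ℚ-+ a (b ∸ a) ⟨
    ℕ→ℚ (a ℕ.+ (b ∸ a))      ≡⟨ cong ℕ→ℚ (ℕ.m+[n∸m]≡n a≤b) ⟩
    ℕ→ℚ b                    ∎
    where open ≤-Reasoning

  ℕ→ℚ-*-reciprocal : ∀ d → ℕ→ℚ (suc d) * (ℤ.+ 1 / suc d) ≡ 1ℚ
  ℕ→ℚ-*-reciprocal d
    rewrite ℕ→ℚ≡mkℚ (suc d) | ↥p/↧p≡p (mkℚ (ℤ.+ 1) d (Coprime.1-coprimeTo (suc d)))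
    = *-inverseʳ (mkℚ ℤ.+[1+ d ] 0 (Coprime.sym (Coprime.1-coprimeTo (suc d))))

  ≤-+⇒-≤ : ∀ {p q r} → p ≤ q + r → p - r ≤ q
  ≤-+⇒-≤ {p} {q} {r} p≤q+r = begin
    p - r        ≤⟨ +-monoˡ-≤ (- r) p≤q+r ⟩
    q + r - r    ≡⟨ solve 2 (λ q r → q :+ r :- r := q) refl q r ⟩
    q            ∎
    where
    open ≤-Reasoning
    open +-*-Solver

  module _ (f : ℕ → ℚ) where

    maxUpTo : ℕ → ℚ
    maxUpTo zero    = f zero
    maxUpTo (suc K) = f (suc K) ⊔ maxUpTo K

    maxUpTo-upper : ∀ {k K} → k ℕ.≤ K → f k ≤ maxUpTo K
    maxUpTo-upper {K = zero}  ℕ.z≤n = ≤-refl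
    maxUpTo-upper {k} {suc K} k≤K with ℕ.m≤n⇒m<n∨m≡n k≤K
    ... | inj₂ refl = p≤p⊔q (f (suc K)) (maxUpTo K)
    ... | inj₁ k<K  = ≤-trans (maxUpTo-upper (ℕ.≤-pred k<K)) (p≤q⊔p (f (suc K)) (maxUpTo K))

    maxUpTo-attained : ∀ K → Σ[ k ∈ ℕ ] k ℕ.≤ K × f k ≡ maxUpTo K
    maxUpTo-attained zero = zero , ℕ.z≤n , refl
    maxUpTo-attained (suc K) with ⊔-sel (f (suc K)) (maxUpTo K)
    ... | inj₁ max≡new = suc K , ℕ.≤-refl , sym max≡new
    ... | inj₂ max≡old with maxUpTo-attained K
    ...   | k , k≤K , fk≡ = k , ℕ.m≤n⇒m≤1+n k≤K , trans fk≡ (sym max≡old)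

    maxUpTo-least : ∀ {K q} → (∀ k → k ℕ.≤ K → f k ≤ q) → maxUpTo K ≤ q
    maxUpTo-least {zero}  bound = bound zero ℕ.z≤n
    maxUpTo-least {suc K} bound =
      ⊔-lub (bound (suc K) ℕ.≤-refl) (maxUpTo-least (λ k k≤K → bound k (ℕ.m≤n⇒m≤1+n k≤K)))

module Booleans where

  open import Data.Bool using (Bool; true; false; _∧_; not)
  open import Data.Product using (_×_; _,_)
  open import Relation.Binary.PropositionalEquality using (refl)
  open import Relation.Nullary using (Dec; yes; no; ¬_)
  open import Relation.Nullary.Decidable using (⌊_⌋)
  open import Relation.Nullary.Negation using (contradiction)

  ∧-true⁻ : ∀ {x y} → x ∧ y ≡ true → x ≡ true × y ≡ true
  ∧-true⁻ {true} {true} _ = refl , refl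

  ⌊⌋-true⁺ : ∀ {A : Set} (d : Dec A) → A → ⌊ d ⌋ ≡ true
  ⌊⌋-true⁺ (yes _)  _ = refl
  ⌊⌋-true⁺ (no  ¬a) a = contradiction a ¬a

  ⌊⌋-false⁺ : ∀ {A : Set} (d : Dec A) → ¬ A → ⌊ d ⌋ ≡ false
  ⌊⌋-false⁺ (yes a) ¬a = contradiction a ¬a
  ⌊⌋-false⁺ (no  _) _  = refl

  ⌊⌋-true⁻ : ∀ {A : Set} {d : Dec A} → ⌊ d ⌋ ≡ true → A
  ⌊⌋-true⁻ {d = yes a} _ = a

  not-⌊⌋-true⁻ : ∀ {A : Set} {d : Dec A} → not ⌊ d ⌋ ≡ true → ¬ A
  not-⌊⌋-true⁻ {d = no ¬a} _ = ¬a

module Sums where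

  open import Algebra.Bundles using (CommutativeRing)
  import Algebra.Properties.Semiring.Sum
  open import Data.Empty using (⊥-elim)
  open import Data.Fin using (Fin; zero; suc; _≟_)
  open import Data.List as List using (foldr)
  open import Data.Rational as ℚ using (ℚ; 0ℚ; 1ℚ; _+_; _*_; _-_; -_)
  import Data.Rational.Properties as ℚ
  open import Function using (_∘_; id)
  open import Relation.Binary.PropositionalEquality
  open import Relation.Nullary using (yes; no)

  module ℚΣ = Algebra.Properties.Semiring.Sum (CommutativeRing.semiring ℚ.+-*-commutativeRing)
  open ℚΣ public using (∑-comm; ∑-distrib-+; *-distribˡ-sum; *-distribʳ-sum)
    renaming (sum to ∑; sum-cong-≗ to ∑-cong; sum-replicate-zero to ∑-zero)

  foldr-tabulate : ∀ {n m} (f : Fin n → ℚ) (h : Fin m → Fin n) →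
    foldr (λ i acc → f i + acc) 0ℚ (List.tabulate h) ≡ ∑ (f ∘ h)
  foldr-tabulate {m = zero}  f h = refl
  foldr-tabulate {m = suc m} f h = cong (f (h zero) +_) (foldr-tabulate f (h ∘ suc))

  Σℚ≡∑ : ∀ {n} (f : Fin n → ℚ) → Σℚ f ≡ ∑ f
  Σℚ≡∑ f = foldr-tabulate f id

  ∑-neg : ∀ {n} (f : Fin n → ℚ) → ∑ (λ i → - f i) ≡ - ∑ f
  ∑-neg {zero}  f = refl
  ∑-neg {suc n} f = begin
    - f zero + ∑ (λ i → - f (suc i))   ≡⟨ cong (- f zero +_) (∑-neg (f ∘ suc)) ⟩
    - f zero + - ∑ (f ∘ suc)            ≡⟨ ℚ.neg-distrib-+ (f zero) (∑ (f ∘ suc)) ⟨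
    - ∑ f                               ∎
    where open ≡-Reasoning

  ∑-distrib-sub : ∀ {n} (f g : Fin n → ℚ) → ∑ (λ i → f i - g i) ≡ ∑ f - ∑ g
  ∑-distrib-sub f g = trans (∑-distrib-+ f (λ i → - g i)) (cong (∑ f +_) (∑-neg g))

  ∑-mono-≤ : ∀ {n} {f g : Fin n → ℚ} → (∀ i → f i ℚ.≤ g i) → ∑ f ℚ.≤ ∑ g
  ∑-mono-≤ {zero}  f≤g = ℚ.≤-refl
  ∑-mono-≤ {suc n} f≤g = ℚ.+-mono-≤ (f≤g zero) (∑-mono-≤ (f≤g ∘ suc))

  δ : ∀ {n} → Fin n → Fin n → ℚ
  δ i j with i ≟ j
  ... | yes _ = 1ℚ
  ... | no  _ = 0ℚ

  δ-refl : ∀ {n} (i : Fin n) → δ i i ≡ 1ℚ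
  δ-refl i with i ≟ i
  ... | yes _  = refl
  ... | no i≢i = ⊥-elim (i≢i refl)

  δ-≢ : ∀ {n} {i j : Fin n} → i ≢ j → δ i j ≡ 0ℚ
  δ-≢ {i = i} {j} i≢j with i ≟ j
  ... | yes i≡j = ⊥-elim (i≢j i≡j)
  ... | no  _   = refl

  δ-sym : ∀ {n} (i j : Fin n) → δ i j ≡ δ j i
  δ-sym i j with i ≟ j | j ≟ i
  ... | yes _   | yes _   = refl
  ... | no  _   | no  _   = refl
  ... | yes i≡j | no  j≢i = ⊥-elim (j≢i (sym i≡j))
  ... | no  i≢j | yes j≡i = ⊥-elim (i≢j (sym j≡i))

  ∑-δ : ∀ {n} (c : Fin n) (f : Fin n → ℚ) → ∑ (λ j → δ c j * f j) ≡ f c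
  ∑-δ {suc n} zero f = begin
    1ℚ * f zero + ∑ (λ j → 0ℚ * f (suc j))
      ≡⟨ cong₂ _+_ (ℚ.*-identityˡ (f zero)) (∑-cong (ℚ.*-zeroˡ ∘ f ∘ suc)) ⟩
    f zero + ∑ {n} (λ _ → 0ℚ)
      ≡⟨ cong (f zero +_) (∑-zero n) ⟩
    f zero + 0ℚ
      ≡⟨ ℚ.+-identityʳ (f zero) ⟩
    f zero ∎
    where open ≡-Reasoning
  ∑-δ {suc n} (suc c) f = begin
    0ℚ * f zero + ∑ (λ j → δ (suc c) (suc j) * f (suc j))   ≡⟨ cong₂ _+_ (ℚ.*-zeroˡ (f zero)) (∑-cong δ-suc) ⟩
    0ℚ + ∑ (λ j → δ c j * f (suc j))                        ≡⟨ ℚ.+-identityˡ _ ⟩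
    ∑ (λ j → δ c j * f (suc j))                             ≡⟨ ∑-δ c (f ∘ suc) ⟩
    f (suc c)                                               ∎
    where
    open ≡-Reasoning
    δ-suc : ∀ j → δ (suc c) (suc j) * f (suc j) ≡ δ c j * f (suc j)
    δ-suc j with c ≟ j
    ... | yes _ = refl
    ... | no  _ = refl

module Counting where

  open Rationals
  open Sums
  import Algebra.Properties.Semiring.Sum
  import Algebra.Properties.CommutativeSemigroup
  open import Data.Bool using (Bool; true; false; if_then_else_; _∨_)
  import Data.Bool.Properties as 𝔹
  open import Data.Fin using (Fin; zero; suc)
  import Data.Fin.Properties as Fin
  import Data.List as List
  open import Data.Nat as ℕ using (ℕ; zero; suc)
  import Data.Nat.Properties as ℕ
  open import Data.Product using (Σ-syntax; _,_)
  open import Data.Rational as ℚ using (ℚ; 0ℚ; _+_; _*_)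
  import Data.Rational.Properties as ℚ
  open import Function using (_∘_; id)
  open import Relation.Binary.PropositionalEquality

  module ℕΣ = Algebra.Properties.Semiring.Sum ℕ.+-*-semiring
  module +-CS = Algebra.Properties.CommutativeSemigroup ℕ.+-commutativeSemigroup
  open ℕΣ public using () renaming (sum to sumℕ)

  ind : Bool → ℕ
  ind true  = 1
  ind false = 0

  length-filter-tabulate : ∀ {n m} (p : Fin n → Bool) (h : Fin m → Fin n) →
    List.length (List.filter (λ i → p i 𝔹.≟ true) (List.tabulate h)) ≡ sumℕ (ind ∘ p ∘ h)
  length-filter-tabulate {m = zero}  p h = refl
  length-filter-tabulate {m = suc m} p h with p (h zero)
  ... | true  = cong suc (length-filter-tabulate p (h ∘ suc))
  ... | false = length-filter-tabulate p (h ∘ suc)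

  count≡sumℕ : ∀ {n} (p : Fin n → Bool) → count p ≡ sumℕ (ind ∘ p)
  count≡sumℕ p = length-filter-tabulate p id

  sumℕ-mono-≤ : ∀ {n} {f g : Fin n → ℕ} → (∀ i → f i ℕ.≤ g i) → sumℕ f ℕ.≤ sumℕ g
  sumℕ-mono-≤ {zero}  f≤g = ℕ.z≤n
  sumℕ-mono-≤ {suc n} f≤g = ℕ.+-mono-≤ (f≤g zero) (sumℕ-mono-≤ (f≤g ∘ suc))

  sumℕ-mono-< : ∀ {n} {f g : Fin n → ℕ} → (∀ i → f i ℕ.≤ g i) → ∀ j → f j ℕ.< g j → sumℕ f ℕ.< sumℕ g
  sumℕ-mono-< f≤g zero    fj<gj = ℕ.+-mono-<-≤ fj<gj (sumℕ-mono-≤ (f≤g ∘ suc))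
  sumℕ-mono-< f≤g (suc j) fj<gj = ℕ.+-mono-≤-< (f≤g zero) (sumℕ-mono-< (f≤g ∘ suc) j fj<gj)

  sumℕ-if : ∀ {n} (c : ℕ) (p : Fin n → Bool) → sumℕ (λ i → if p i then c else 0) ≡ count p ℕ.* c
  sumℕ-if c p = begin
    sumℕ (λ i → if p i then c else 0)   ≡⟨ ℕΣ.sum-cong-≗ if≡ind* ⟩
    sumℕ (λ i → ind (p i) ℕ.* c)        ≡⟨ ℕΣ.*-distribʳ-sum c (ind ∘ p) ⟨
    sumℕ (ind ∘ p) ℕ.* c                ≡⟨ cong (ℕ._* c) (count≡sumℕ p) ⟨
    count p ℕ.* c                       ∎
    where
    open ≡-Reasoning
    if≡ind* : ∀ i → (if p i then c else 0) ≡ ind (p i) ℕ.* c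
    if≡ind* i with p i
    ... | true  = sym (ℕ.+-identityʳ c)
    ... | false = refl

  _⊆_ : ∀ {n} → (Fin n → Bool) → (Fin n → Bool) → Set
  p ⊆ q = ∀ i → p i ≡ true → q i ≡ true

  ind-mono : ∀ {x y} → (x ≡ true → y ≡ true) → ind x ℕ.≤ ind y
  ind-mono {false} x⇒y = ℕ.z≤n
  ind-mono {true}  x⇒y rewrite x⇒y refl = ℕ.≤-refl

  sumℕ-≤-+-if : ∀ {n} {f g : Fin n → ℕ} (p : Fin n → Bool) (c : ℕ) →
    (∀ i → f i ℕ.≤ g i ℕ.+ (if p i then c else 0)) → sumℕ f ℕ.≤ sumℕ g ℕ.+ count p ℕ.* c
  sumℕ-≤-+-if {f = f} {g} p c f≤g+ = begin
    sumℕ f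
      ≤⟨ sumℕ-mono-≤ f≤g+ ⟩
    sumℕ (λ i → g i ℕ.+ (if p i then c else 0))
      ≡⟨ ℕΣ.∑-distrib-+ g (λ i → if p i then c else 0) ⟩
    sumℕ g ℕ.+ sumℕ (λ i → if p i then c else 0)
      ≡⟨ cong (sumℕ g ℕ.+_) (sumℕ-if c p) ⟩
    sumℕ g ℕ.+ count p ℕ.* c ∎
    where open ℕ.≤-Reasoning

  sumℕ-≤-update : ∀ {n} {f g : Fin n → ℕ} (v : Fin n) (c : ℕ) →
    (∀ u → u ≢ v → f u ≡ g u) → f v ℕ.≤ g v ℕ.+ c → sumℕ f ℕ.≤ sumℕ g ℕ.+ c
  sumℕ-≤-update {suc n} {f} {g} zero c same fv≤ = begin
    f zero ℕ.+ sumℕ (f ∘ suc)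
      ≤⟨ ℕ.+-mono-≤ fv≤ (ℕ.≤-reflexive (ℕΣ.sum-cong-≗ (λ u → same (suc u) λ ()))) ⟩
    g zero ℕ.+ c ℕ.+ sumℕ (g ∘ suc)
      ≡⟨ +-CS.xy∙z≈xz∙y (g zero) c (sumℕ (g ∘ suc)) ⟩
    sumℕ g ℕ.+ c ∎
    where open ℕ.≤-Reasoning
  sumℕ-≤-update {suc n} {f} {g} (suc v) c same fv≤ = begin
    f zero ℕ.+ sumℕ (f ∘ suc)          ≤⟨ ℕ.+-mono-≤ (ℕ.≤-reflexive (same zero λ ())) rest ⟩
    g zero ℕ.+ (sumℕ (g ∘ suc) ℕ.+ c)  ≡⟨ ℕ.+-assoc (g zero) (sumℕ (g ∘ suc)) c ⟨
    sumℕ g ℕ.+ c                       ∎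
    where
    open ℕ.≤-Reasoning
    rest = sumℕ-≤-update v c (λ u u≢v → same (suc u) (u≢v ∘ Fin.suc-injective)) fv≤

  count-mono-≤ : ∀ {n} {p q : Fin n → Bool} → p ⊆ q → count p ℕ.≤ count q
  count-mono-≤ {p = p} {q} p⊆q
    rewrite count≡sumℕ p | count≡sumℕ q = sumℕ-mono-≤ (λ i → ind-mono (p⊆q i))

  count-mono-< : ∀ {n} {p q : Fin n → Bool} → p ⊆ q → ∀ j → p j ≡ false → q j ≡ true → count p ℕ.< count q
  count-mono-< {p = p} {q} p⊆q j pj qj
    rewrite count≡sumℕ p | count≡sumℕ q =
      sumℕ-mono-< (λ i → ind-mono (p⊆q i)) j (subst₂ (λ x y → ind x ℕ.< ind y) (sym pj) (sym qj) ℕ.≤-refl)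

  ind-≤1 : ∀ x → ind x ℕ.≤ 1
  ind-≤1 true  = ℕ.≤-refl
  ind-≤1 false = ℕ.z≤n

  sumℕ-ind-≤ : ∀ {n} (p : Fin n → Bool) → sumℕ (ind ∘ p) ℕ.≤ n
  sumℕ-ind-≤ {zero}  p = ℕ.z≤n
  sumℕ-ind-≤ {suc n} p = ℕ.+-mono-≤ (ind-≤1 (p zero)) (sumℕ-ind-≤ (p ∘ suc))

  count-≤ : ∀ {n} (p : Fin n → Bool) → count p ℕ.≤ n
  count-≤ p rewrite count≡sumℕ p = sumℕ-ind-≤ p

  count-none : ∀ {n} {p : Fin n → Bool} → (∀ i → p i ≡ false) → count p ≡ 0
  count-none {n} {p} none = begin
    count p           ≡⟨ count≡sumℕ p ⟩
    sumℕ (ind ∘ p)    ≡⟨ ℕΣ.sum-cong-≗ (cong ind ∘ none) ⟩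
    sumℕ {n} (λ _ → 0) ≡⟨ ℕΣ.sum-replicate-zero n ⟩
    0                 ∎
    where open ≡-Reasoning

  ℕ→ℚ-sumℕ : ∀ {n} (f : Fin n → ℕ) → ℕ→ℚ (sumℕ f) ≡ ∑ (ℕ→ℚ ∘ f)
  ℕ→ℚ-sumℕ {zero}  f = refl
  ℕ→ℚ-sumℕ {suc n} f =
    trans (ℕ→ℚ-+ (f zero) (sumℕ (f ∘ suc))) (cong (ℕ→ℚ (f zero) +_) (ℕ→ℚ-sumℕ (f ∘ suc)))

  ∑-if : ∀ {n} (c : ℚ) (p : Fin n → Bool) → ∑ (λ i → if p i then c else 0ℚ) ≡ ℕ→ℚ (count p) * c
  ∑-if c p = begin
    ∑ (λ i → if p i then c else 0ℚ)   ≡⟨ ∑-cong if≡ind* ⟩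
    ∑ (λ i → ℕ→ℚ (ind (p i)) * c)     ≡⟨ *-distribʳ-sum c (ℕ→ℚ ∘ ind ∘ p) ⟨
    ∑ (ℕ→ℚ ∘ ind ∘ p) * c             ≡⟨ cong (_* c) (ℕ→ℚ-sumℕ (ind ∘ p)) ⟨
    ℕ→ℚ (sumℕ (ind ∘ p)) * c          ≡⟨ cong (λ m → ℕ→ℚ m * c) (count≡sumℕ p) ⟨
    ℕ→ℚ (count p) * c                 ∎
    where
    open ≡-Reasoning
    if≡ind* : ∀ i → (if p i then c else 0ℚ) ≡ ℕ→ℚ (ind (p i)) * c
    if≡ind* i with p i
    ... | true  = sym (ℚ.*-identityˡ c)
    ... | false = sym (ℚ.*-zeroˡ c)

  anyFin : ∀ {n} → (Fin n → Bool) → Bool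
  anyFin {zero}  p = false
  anyFin {suc n} p = p zero ∨ anyFin (p ∘ suc)

  anyFin-intro : ∀ {n} (p : Fin n → Bool) i → p i ≡ true → anyFin p ≡ true
  anyFin-intro p zero    pi rewrite pi = refl
  anyFin-intro p (suc i) pi rewrite anyFin-intro (p ∘ suc) i pi = 𝔹.∨-zeroʳ (p zero)

  anyFin-elim : ∀ {n} (p : Fin n → Bool) → anyFin p ≡ true → Σ[ i ∈ Fin n ] p i ≡ true
  anyFin-elim {suc n} p any with p zero in p0
  ... | true  = zero , p0
  ... | false with anyFin-elim (p ∘ suc) any
  ...   | i , pi = suc i , pi

  anyFin-false⇒ : ∀ {n} (p : Fin n → Bool) → anyFin p ≡ false → ∀ i → p i ≡ false
  anyFin-false⇒ p none i with p i in pi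
  ... | false = refl
  ... | true  = trans (sym (anyFin-intro p i pi)) none

  anyFin-false⇐ : ∀ {n} (p : Fin n → Bool) → (∀ i → p i ≡ false) → anyFin p ≡ false
  anyFin-false⇐ {zero}  p none = refl
  anyFin-false⇐ {suc n} p none rewrite none zero = anyFin-false⇐ (p ∘ suc) (none ∘ suc)

module Blocks (n k′ : ℕ) where

  open Sums
  open import Data.Fin as Fin using (Fin; toℕ; fromℕ<; _≟_)
  import Data.Fin.Properties as Fin
  open import Data.Nat using (ℕ; suc; _+_; _*_; _≤_; _<_; _⊓_; _/_; _%_; _≤?_; _<?_)
  open import Data.Nat.Properties hiding (_≟_)
  open import Data.Nat.DivMod using (m≡m%n+[m/n]*n; m%n<n)
  open import Data.Product using (Σ-syntax; _×_; _,_; proj₁; proj₂)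
  import Data.Rational as ℚ
  open import Relation.Binary.Definitions using (tri<; tri≈; tri>)
  open import Relation.Binary.PropositionalEquality
  open import Relation.Nullary using (yes; no)
  open import Relation.Nullary.Negation using (contradiction)

  start : ℕ → ℕ
  start = blockStart n k′

  start-mono-≤ : ∀ {i j} → i ≤ j → start i ≤ start j
  start-mono-≤ i≤j = +-mono-≤ (*-monoˡ-≤ (n / suc k′) i≤j) (⊓-monoˡ-≤ (n % suc k′) i≤j)

  start-last : start (suc k′) ≡ n
  start-last = begin
    suc k′ * (n / suc k′) + suc k′ ⊓ (n % suc k′)
      ≡⟨ cong (suc k′ * (n / suc k′) +_) (m≥n⇒m⊓n≡n (<⇒≤ (m%n<n n (suc k′)))) ⟩
    suc k′ * (n / suc k′) + n % suc k′
      ≡⟨ +-comm (suc k′ * (n / suc k′)) (n % suc k′) ⟩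
    n % suc k′ + suc k′ * (n / suc k′)
      ≡⟨ cong (n % suc k′ +_) (*-comm (suc k′) (n / suc k′)) ⟩
    n % suc k′ + n / suc k′ * suc k′
      ≡⟨ m≡m%n+[m/n]*n n (suc k′) ⟨
    n ∎
    where open ≡-Reasoning

  locate : ∀ K i → i < start K → Σ[ j ∈ ℕ ] j < K × start j ≤ i × i < start (suc j)
  locate (suc K) i i<sK with start K ≤? i
  ... | yes sK≤i = K , ≤-refl , sK≤i , i<sK
  ... | no  sK≰i with locate K i (≰⇒> sK≰i)
  ...   | j , j<K , bounds = j , m≤n⇒m≤1+n j<K , bounds

  located-unique : ∀ {i j j′} → start j ≤ i → i < start (suc j) → start j′ ≤ i → i < start (suc j′) → j ≡ j′
  located-unique {j = j} {j′} sj≤i i<sj+1 sj′≤i i<sj′+1 with <-cmp j j′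
  ... | tri< j<j′ _ _ = contradiction (≤-<-trans (start-mono-≤ j<j′) (≤-<-trans sj′≤i i<sj+1)) (<-irrefl refl)
  ... | tri≈ _ j≡j′ _ = j≡j′
  ... | tri> _ _ j>j′ = contradiction (≤-<-trans (start-mono-≤ j>j′) (≤-<-trans sj≤i i<sj′+1)) (<-irrefl refl)

  private
    located : (i : Fin n) → Σ[ j ∈ ℕ ] j < suc k′ × start j ≤ toℕ i × toℕ i < start (suc j)
    located i = locate (suc k′) (toℕ i) (subst (toℕ i <_) (sym start-last) (Fin.toℕ<n i))

  block : Fin n → Fin (suc k′)
  block i = fromℕ< (proj₁ (proj₂ (located i)))

  start-block-≤ : ∀ i → start (toℕ (block i)) ≤ toℕ i
  start-block-≤ i rewrite Fin.toℕ-fromℕ< (proj₁ (proj₂ (located i))) =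
    proj₁ (proj₂ (proj₂ (located i)))

  <-end-block : ∀ i → toℕ i < start (suc (toℕ (block i)))
  <-end-block i rewrite Fin.toℕ-fromℕ< (proj₁ (proj₂ (located i))) =
    proj₂ (proj₂ (proj₂ (located i)))

  block-unique : ∀ i j → start (toℕ j) ≤ toℕ i → toℕ i < start (suc (toℕ j)) → block i ≡ j
  block-unique i j sj≤i i<sj+1 =
    Fin.toℕ-injective (located-unique (start-block-≤ i) (<-end-block i) sj≤i i<sj+1)

  end-≤ : ∀ (j : Fin (suc k′)) → start (suc (toℕ j)) ≤ n
  end-≤ j = subst (start (suc (toℕ j)) ≤_) start-last (start-mono-≤ (Fin.toℕ<n j))

  Ŵ≡δ : ∀ i j → Ŵ n k′ i j ≡ δ (block i) j
  Ŵ≡δ i j with start (toℕ j) ≤? toℕ i | toℕ i <? start (suc (toℕ j))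
  ... | yes sj≤i | yes i<sj+1 rewrite block-unique i j sj≤i i<sj+1 = sym (δ-refl j)
  ... | no  sj≰i | _ with block i ≟ j
  ...   | yes refl = contradiction (start-block-≤ i) sj≰i
  ...   | no  _    = refl
  Ŵ≡δ i j | yes _ | no i≮sj+1 with block i ≟ j
  ...   | yes refl = contradiction (<-end-block i) i≮sj+1
  ...   | no  _    = refl

  W≡δ : ∀ a b → W n k′ a b ≡ δ (block a) (block b)
  W≡δ a b = begin
    Σℚ (λ l → Ŵ n k′ a l ℚ.* Ŵ n k′ b l)         ≡⟨ Σℚ≡∑ (λ l → Ŵ n k′ a l ℚ.* Ŵ n k′ b l) ⟩
    ∑ (λ l → Ŵ n k′ a l ℚ.* Ŵ n k′ b l)          ≡⟨ ∑-cong (λ l → cong₂ ℚ._*_ (Ŵ≡δ a l) (Ŵ≡δ b l)) ⟩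
    ∑ (λ l → δ (block a) l ℚ.* δ (block b) l)      ≡⟨ ∑-δ (block a) (δ (block b)) ⟩
    δ (block b) (block a)                        ≡⟨ δ-sym (block b) (block a) ⟩
    δ (block a) (block b)                        ∎
    where open ≡-Reasoning

module PermutationConjugation where

  open Sums
  open import Data.Fin using (Fin; _≟_)
  open import Data.Rational using (ℚ; _*_)
  open import Data.Rational.Properties using (*-assoc; *-comm)
  open import Relation.Binary.PropositionalEquality
  open import Relation.Nullary using (yes; no)

  ⊗-entry : ∀ {m p q} (P : Mat m p) (Q : Mat p q) a b → (P ⊗ Q) a b ≡ ∑ (λ l → P a l * Q l b)
  ⊗-entry P Q a b = Σℚ≡∑ (λ l → P a l * Q l b)

  tr-⊗ : ∀ {m p} (P : Mat m p) (Q : Mat p m) → tr (P ⊗ Q) ≡ ∑ (λ a → ∑ (λ b → P a b * Q b a))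
  tr-⊗ P Q = trans (Σℚ≡∑ (λ a → (P ⊗ Q) a a)) (∑-cong (λ a → ⊗-entry P Q a a))

  ∑-contract : ∀ {m p} (f : Fin m → ℚ) (g : Fin m → Fin p → ℚ) (h : Fin p → ℚ) →
    ∑ (λ b → ∑ (λ l → f l * g l b) * h b) ≡ ∑ (λ l → f l * ∑ (λ b → g l b * h b))
  ∑-contract f g h = begin
    ∑ (λ b → ∑ (λ l → f l * g l b) * h b)     ≡⟨ ∑-cong (λ b → *-distribʳ-sum (h b) (λ l → f l * g l b)) ⟩
    ∑ (λ b → ∑ (λ l → f l * g l b * h b))     ≡⟨ ∑-comm (λ b l → f l * g l b * h b) ⟩
    ∑ (λ l → ∑ (λ b → f l * g l b * h b))     ≡⟨ ∑-cong (λ l → ∑-cong (λ b → *-assoc (f l) (g l b) (h b))) ⟩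
    ∑ (λ l → ∑ (λ b → f l * (g l b * h b)))   ≡⟨ ∑-cong (λ l → *-distribˡ-sum (f l) (λ b → g l b * h b)) ⟨
    ∑ (λ l → f l * ∑ (λ b → g l b * h b))     ∎
    where open ≡-Reasoning

  module _ {n} {E : Graph n} (σ : TopOrder E) where

    open TopOrder σ

    permMat≡δ : ∀ i a → permMat σ i a ≡ δ (timeOf i) a
    permMat≡δ i a with timeOf i ≟ a
    ... | yes _ = refl
    ... | no  _ = refl

    ∑-permMat : ∀ i (f : Fin n → ℚ) → ∑ (λ a → permMat σ i a * f a) ≡ f (timeOf i)
    ∑-permMat i f = trans (∑-cong (λ a → cong (_* f a) (permMat≡δ i a))) (∑-δ (timeOf i) f)

    tr-conjugate : (A B : Mat n n) →
      tr ((((permMat σ ᵀ) ⊗ A) ⊗ permMat σ) ⊗ B) ≡ ∑ (λ i → ∑ (λ l → A i l * B (timeOf l) (timeOf i)))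
    tr-conjugate A B = begin
      tr ((XᵀA ⊗ X) ⊗ B)
        ≡⟨ tr-⊗ (XᵀA ⊗ X) B ⟩
      ∑ (λ a → ∑ (λ b → (XᵀA ⊗ X) a b * B b a))
        ≡⟨ ∑-cong (λ a → ∑-cong (λ b → cong (_* B b a) (⊗-entry XᵀA X a b))) ⟩
      ∑ (λ a → ∑ (λ b → ∑ (λ l → XᵀA a l * X l b) * B b a))
        ≡⟨ ∑-cong (λ a → ∑-contract (XᵀA a) X (λ b → B b a)) ⟩
      ∑ (λ a → ∑ (λ l → XᵀA a l * ∑ (λ b → X l b * B b a)))
        ≡⟨ ∑-cong (λ a → ∑-cong (λ l → cong (XᵀA a l *_) (∑-permMat l (λ b → B b a)))) ⟩
      ∑ (λ a → ∑ (λ l → XᵀA a l * B (timeOf l) a))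
        ≡⟨ ∑-comm (λ a l → XᵀA a l * B (timeOf l) a) ⟩
      ∑ (λ l → ∑ (λ a → XᵀA a l * B (timeOf l) a))
        ≡⟨ ∑-cong (λ l → ∑-cong (λ a → cong (_* B (timeOf l) a) (XᵀA-entry a l))) ⟩
      ∑ (λ l → ∑ (λ a → ∑ (λ i → A i l * X i a) * B (timeOf l) a))
        ≡⟨ ∑-cong (λ l → ∑-contract (λ i → A i l) X (B (timeOf l))) ⟩
      ∑ (λ l → ∑ (λ i → A i l * ∑ (λ a → X i a * B (timeOf l) a)))
        ≡⟨ ∑-cong (λ l → ∑-cong (λ i → cong (A i l *_) (∑-permMat i (B (timeOf l))))) ⟩
      ∑ (λ l → ∑ (λ i → A i l * B (timeOf l) (timeOf i)))
        ≡⟨ ∑-comm (λ l i → A i l * B (timeOf l) (timeOf i)) ⟩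
      ∑ (λ i → ∑ (λ l → A i l * B (timeOf l) (timeOf i)))
        ∎
      where
      open ≡-Reasoning
      X = permMat σ
      XᵀA = (X ᵀ) ⊗ A
      XᵀA-entry : ∀ a l → XᵀA a l ≡ ∑ (λ i → A i l * X i a)
      XᵀA-entry a l = trans (⊗-entry (X ᵀ) A a l) (∑-cong (λ i → *-comm (X i a) (A i l)))

module CutWeights {n : ℕ} (E : Graph n) where

  open Rationals
  open Sums
  open Counting
  open import Data.Bool using (Bool; true; false; if_then_else_; _∧_; not)
  open import Data.Fin using (Fin; _≟_)
  open import Data.Nat using (zero; suc)
  import Data.Integer as ℤ
  open import Data.Rational using (ℚ; 0ℚ; 1ℚ; _+_; _*_; _-_; _≤_; _/_)
  open import Data.Rational.Properties hiding (_≟_)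
  open import Relation.Binary.PropositionalEquality
  open import Relation.Nullary using (Dec; yes; no)
  open import Data.Rational.Solver using (module +-*-Solver)
  open import Relation.Nullary.Decidable using (⌊_⌋)

  reciprocal : ℕ → ℚ
  reciprocal zero    = 0ℚ
  reciprocal (suc d) = ℤ.+ 1 / suc d

  reciprocal-nonNeg : ∀ d → 0ℚ ≤ reciprocal d
  reciprocal-nonNeg zero    = ≤-refl
  reciprocal-nonNeg (suc d) = nonNegative⁻¹ _ {{normalize-nonNeg 1 (suc d)}}

  ℕ→ℚ-*-reciprocal-≤ : ∀ d → ℕ→ℚ d * reciprocal d ≤ 1ℚ
  ℕ→ℚ-*-reciprocal-≤ zero    = ≤ᵇ⇒≤ _
  ℕ→ℚ-*-reciprocal-≤ (suc d) = ≤-reflexive (ℕ→ℚ-*-reciprocal d)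

  wdir≡if : ∀ u v → wdir E u v ≡ (if E u v then reciprocal (dout E u) else 0ℚ)
  wdir≡if u v with E u v | dout E u
  ... | false | _     = refl
  ... | true  | zero  = refl
  ... | true  | suc d = refl

  wdir-nonNeg : ∀ u v → 0ℚ ≤ wdir E u v
  wdir-nonNeg u v rewrite wdir≡if u v with E u v
  ... | true  = reciprocal-nonNeg (dout E u)
  ... | false = ≤-refl

  ∑-wdir-≤ : ∀ u → ∑ (wdir E u) ≤ 1ℚ
  ∑-wdir-≤ u = begin
    ∑ (wdir E u)                                        ≡⟨ ∑-cong (wdir≡if u) ⟩
    ∑ (λ v → if E u v then reciprocal (dout E u) else 0ℚ)   ≡⟨ ∑-if (reciprocal (dout E u)) (E u) ⟩
    ℕ→ℚ (dout E u) * reciprocal (dout E u)              ≤⟨ ℕ→ℚ-*-reciprocal-≤ (dout E u) ⟩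
    1ℚ                                                  ∎
    where open ≤-Reasoning

  D̃≡δ* : ∀ i l → D̃ E i l ≡ δ i l * Σℚ (Ã E i)
  D̃≡δ* i l with i ≟ l
  ... | yes _ = sym (*-identityˡ (Σℚ (Ã E i)))
  ... | no  _ = sym (*-zeroˡ (Σℚ (Ã E i)))

  module _ {m : ℕ} (c : Fin n → Fin m) where

    crossing : Fin n → Bool
    crossing u = anyFin (λ w → E u w ∧ not ⌊ c u ≟ c w ⌋)

    separated : Fin n → Fin n → ℚ
    separated i l = 1ℚ - δ (c i) (c l)

    separated-sym : ∀ i l → separated i l ≡ separated l i
    separated-sym i l = cong (1ℚ -_) (δ-sym (c i) (c l))

    separated-≡ : ∀ {i l} → c i ≡ c l → separated i l ≡ 0ℚ
    separated-≡ {i} {l} ci≡cl rewrite ci≡cl | δ-refl (c l) = +-inverseʳ 1ℚ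

    separated-≢ : ∀ {i l} → c i ≢ c l → separated i l ≡ 1ℚ
    separated-≢ {i} {l} ci≢cl = cong (1ℚ -_) (δ-≢ ci≢cl)

    wdir-*-separated-≤ : ∀ u w → wdir E u w * separated u w ≤ wdir E u w
    wdir-*-separated-≤ u w = byColour (c u ≟ c w)
      where
      byColour : Dec (c u ≡ c w) → wdir E u w * separated u w ≤ wdir E u w
      byColour (yes cu≡cw) =
        ≤-trans (≤-reflexive (trans (cong (wdir E u w *_) (separated-≡ cu≡cw)) (*-zeroʳ (wdir E u w)))) (wdir-nonNeg u w)
      byColour (no  cu≢cw) =
        ≤-reflexive (trans (cong (wdir E u w *_) (separated-≢ cu≢cw)) (*-identityʳ (wdir E u w)))

    wdir-*-separated≡0 : ∀ u w → (E u w ∧ not ⌊ c u ≟ c w ⌋) ≡ false → wdir E u w * separated u w ≡ 0ℚ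
    wdir-*-separated≡0 u w = byEdge (E u w) refl (c u ≟ c w)
      where
      byEdge : ∀ b → E u w ≡ b → (d : Dec (c u ≡ c w)) → (b ∧ not ⌊ d ⌋) ≡ false →
               wdir E u w * separated u w ≡ 0ℚ
      byEdge false euw _ _ = trans (cong (_* separated u w) wdir≡0) (*-zeroˡ (separated u w))
        where
        wdir≡0 : wdir E u w ≡ 0ℚ
        wdir≡0 = trans (wdir≡if u w) (cong (if_then reciprocal (dout E u) else 0ℚ) euw)
      byEdge true _ (yes cu≡cw) _ = trans (cong (wdir E u w *_) (separated-≡ cu≡cw)) (*-zeroʳ (wdir E u w))

    ∑-wdir-*-separated-≤ : ∀ u → ∑ (λ w → wdir E u w * separated u w) ≤ (if crossing u then 1ℚ else 0ℚ)
    ∑-wdir-*-separated-≤ u with crossing u in cross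
    ... | true  = ≤-trans (∑-mono-≤ (wdir-*-separated-≤ u)) (∑-wdir-≤ u)
    ... | false =
      ≤-reflexive (trans (∑-cong (λ w → wdir-*-separated≡0 u w (anyFin-false⇒ _ cross w))) (∑-zero n))

    cutWeight : ℚ
    cutWeight = ∑ (λ u → ∑ (λ w → wdir E u w * separated u w))

    cutWeight-≤ : cutWeight ≤ ℕ→ℚ (count crossing)
    cutWeight-≤ = begin
      cutWeight                                   ≤⟨ ∑-mono-≤ ∑-wdir-*-separated-≤ ⟩
      ∑ (λ u → if crossing u then 1ℚ else 0ℚ)     ≡⟨ ∑-if 1ℚ crossing ⟩
      ℕ→ℚ (count crossing) * 1ℚ                   ≡⟨ *-identityʳ _ ⟩
      ℕ→ℚ (count crossing)                        ∎
      where open ≤-Reasoning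

    ∑-D̃-*-δ : ∀ i → ∑ (λ l → D̃ E i l * δ (c i) (c l)) ≡ ∑ (Ã E i)
    ∑-D̃-*-δ i = begin
      ∑ (λ l → D̃ E i l * δ (c i) (c l))              ≡⟨ ∑-cong (λ l → cong (_* δ (c i) (c l)) (D̃≡δ* i l)) ⟩
      ∑ (λ l → δ i l * Σℚ (Ã E i) * δ (c i) (c l))   ≡⟨ ∑-cong (λ l → *-assoc (δ i l) _ _) ⟩
      ∑ (λ l → δ i l * (Σℚ (Ã E i) * δ (c i) (c l))) ≡⟨ ∑-δ i (λ l → Σℚ (Ã E i) * δ (c i) (c l)) ⟩
      Σℚ (Ã E i) * δ (c i) (c i)                     ≡⟨ cong (Σℚ (Ã E i) *_) (δ-refl (c i)) ⟩
      Σℚ (Ã E i) * 1ℚ                                ≡⟨ *-identityʳ _ ⟩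
      Σℚ (Ã E i)                                     ≡⟨ Σℚ≡∑ (Ã E i) ⟩
      ∑ (Ã E i)                                      ∎
      where open ≡-Reasoning

    ∑-L̃-*-δ : ∀ i → ∑ (λ l → L̃ E i l * δ (c i) (c l)) ≡ ∑ (λ l → Ã E i l * separated i l)
    ∑-L̃-*-δ i = begin
      ∑ (λ l → L̃ E i l * same l)            ≡⟨ ∑-cong (λ l → *-distribʳ-sub (D̃ E i l) (Ã E i l) (same l)) ⟩
      ∑ (λ l → D̃ E i l * same l - Ãsame l)  ≡⟨ ∑-distrib-sub (λ l → D̃ E i l * same l) Ãsame ⟩
      ∑ (λ l → D̃ E i l * same l) - ∑ Ãsame  ≡⟨ cong (_- ∑ Ãsame) (∑-D̃-*-δ i) ⟩
      ∑ (Ã E i) - ∑ Ãsame                   ≡⟨ ∑-distrib-sub (Ã E i) Ãsame ⟨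
      ∑ (λ l → Ã E i l - Ãsame l)           ≡⟨ ∑-cong (λ l → x-x*y≡x*[1-y] (Ã E i l) (same l)) ⟩
      ∑ (λ l → Ã E i l * separated i l)     ∎
      where
      open ≡-Reasoning
      open +-*-Solver
      same Ãsame : Fin n → ℚ
      same l = δ (c i) (c l)
      Ãsame l = Ã E i l * same l
      *-distribʳ-sub : ∀ x y z → (x - y) * z ≡ x * z - y * z
      *-distribʳ-sub = solve 3 (λ x y z → (x :- y) :* z := x :* z :- y :* z) refl
      x-x*y≡x*[1-y] : ∀ x y → x - x * y ≡ x * (1ℚ - y)
      x-x*y≡x*[1-y] = solve 2 (λ x y → x :- x :* y := x :* (con 1ℚ :- y)) refl

    ∑-∑-L̃-*-δ : ∑ (λ i → ∑ (λ l → L̃ E i l * δ (c i) (c l))) ≡ cutWeight + cutWeight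
    ∑-∑-L̃-*-δ = begin
      ∑ (λ i → ∑ (λ l → L̃ E i l * δ (c i) (c l)))
        ≡⟨ ∑-cong ∑-L̃-*-δ ⟩
      ∑ (λ i → ∑ (λ l → Ã E i l * separated i l))
        ≡⟨ ∑-cong (λ i → ∑-cong (λ l → *-distribʳ-+ (separated i l) (wdir E i l) (wdir E l i))) ⟩
      ∑ (λ i → ∑ (λ l → out i l + into i l))
        ≡⟨ ∑-cong (λ i → ∑-distrib-+ (out i) (into i)) ⟩
      ∑ (λ i → ∑ (out i) + ∑ (into i))
        ≡⟨ ∑-distrib-+ (λ i → ∑ (out i)) (λ i → ∑ (into i)) ⟩
      cutWeight + ∑ (λ i → ∑ (into i))
        ≡⟨ cong (cutWeight +_) transposed ⟩
      cutWeight + cutWeight ∎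
      where
      open ≡-Reasoning
      out into : Fin n → Fin n → ℚ
      out  i l = wdir E i l * separated i l
      into i l = wdir E l i * separated i l
      transposed : ∑ (λ i → ∑ (into i)) ≡ cutWeight
      transposed =
        trans (∑-comm into) (∑-cong (λ l → ∑-cong (λ i → cong (wdir E l i *_) (separated-sym i l))))

module IOLowerBound {n : ℕ} (E : Graph n) (M : ℕ) (σ : TopOrder E) {k : ℕ}
  (block : Fin n → Fin k) (end : Fin k → ℕ)
  (before-end : ∀ u → toℕ (TopOrder.timeOf σ u) ℕ.< end (block u))
  (end-≤ : ∀ j → end j ℕ.≤ n)
  (crossing-after-end : ∀ u w → E u w ≡ true → block u ≢ block w →
                        end (block u) ℕ.≤ toℕ (TopOrder.timeOf σ w))
  where

  open Counting
  open Booleans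
  open CutWeights E using (crossing)
  open TopOrder σ
  open import Data.Bool using (Bool; true; false; if_then_else_; _∧_; not)
  import Data.Bool.Properties as 𝔹
  open import Data.Fin as Fin using (fromℕ<)
  import Data.Fin.Properties as Fin
  open import Data.Nat using (suc; _+_; _*_; _≤_; _<_; _≤?_; _<?_; z≤n; s≤s)
  open import Data.Nat.Properties
  open import Data.Product using (_,_; proj₁; proj₂)
  open import Data.Sum using (inj₁; inj₂)
  open import Function using (_∘_)
  open import Data.Nat.Solver using (module +-*-Solver)
  open import Relation.Binary.PropositionalEquality
  open import Relation.Nullary using (yes; no; ¬_)
  open import Relation.Nullary.Decidable using (⌊_⌋)
  open import Relation.Nullary.Negation using (contradiction)

  time : Fin n → ℕ
  time u = toℕ (timeOf u)

  deadline : Fin n → ℕ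
  deadline u = end (block u)

  stillNeeded : ℕ → Fin n → Bool
  stillNeeded t u = anyFin (λ w → E u w ∧ ⌊ t ≤? time w ⌋)

  stillNeeded-deadline : ∀ u → crossing block u ≡ true → stillNeeded (deadline u) u ≡ true
  stillNeeded-deadline u cross with anyFin-elim _ cross
  ... | w , euw∧separated with ∧-true⁻ euw∧separated
  ...   | euw , separated =
    anyFin-intro _ w (cong₂ _∧_ euw (⌊⌋-true⁺ (deadline u ≤? time w) after-end))
    where after-end = crossing-after-end u w euw (not-⌊⌋-true⁻ separated)

  stranded : (inFast : Bool) → ℕ → Fin n → Bool
  stranded inFast t u = not inFast ∧ stillNeeded t u

  restoreCost : Bool → ℕ
  restoreCost true  = 1
  restoreCost false = 2

  restoreCost-≤ : ∀ inSlow → restoreCost inSlow ≤ 2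
  restoreCost-≤ true  = s≤s z≤n
  restoreCost-≤ false = ≤-refl

  -- A crossing vertex owes the I/Os needed to carry its value past the end of its block:
  -- a store and a load, or only the load once it is in slow memory.  After the deadline the
  -- debt persists only while the value is still needed and absent from fast memory.
  debtAt : (crosses inFast inSlow : Bool) → ℕ → Fin n → ℕ
  debtAt false _      _      _ _ = 0
  debtAt true  inFast inSlow t u =
    if ⌊ t <? deadline u ⌋ then restoreCost inSlow
    else if stranded inFast t u then restoreCost inSlow else 0

  debt : (F S : Fin n → Bool) → ℕ → Fin n → ℕ
  debt F S t u = debtAt (crossing block u) (F u) (S u) t u

  Φ : MState n → ℕ
  Φ ⟨ F , S , t ⟩ = sumℕ (debt F S t)

  openBlocks : ℕ → ℕ
  openBlocks t = count (λ j → ⌊ t <? end j ⌋)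

  -- The 2M reserved per open block pays for the vertices that are in fast memory when their
  -- block closes: there are at most M of them, and each drops a debt of at most 2 without I/O.
  Amortized : MState n → MState n → ℕ → Set
  Amortized s s′ c =
    Φ s + 2 * M * openBlocks (MState.done s′) ≤ c + Φ s′ + 2 * M * openBlocks (MState.done s)

  debtAt-store : ∀ c inFast inSlow t u → inFast ≡ true →
    debtAt c inFast inSlow t u ≤ debtAt c inFast true t u + 1
  debtAt-store false _ _ _ _ _ = z≤n
  debtAt-store true inFast inSlow t u inF with ⌊ t <? deadline u ⌋
  ... | true  = restoreCost-≤ inSlow
  ... | false rewrite inF = z≤n

  debtAt-load : ∀ c inFast inSlow t u → inSlow ≡ true →
    debtAt c inFast inSlow t u ≤ debtAt c true inSlow t u + 1
  debtAt-load false _ _ _ _ _ = z≤n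
  debtAt-load true inFast inSlow t u inS with ⌊ t <? deadline u ⌋
  ... | true  = m≤m+n _ 1
  ... | false rewrite inS with stranded inFast t u
  ...   | true  = ≤-refl
  ...   | false = z≤n

  debtAt-evict : ∀ c inFast inSlow t u → debtAt c inFast inSlow t u ≤ debtAt c false inSlow t u
  debtAt-evict false _ _ _ _ = z≤n
  debtAt-evict true inFast inSlow t u with ⌊ t <? deadline u ⌋ | inFast
  ... | true  | _     = ≤-refl
  ... | false | true  = z≤n
  ... | false | false = ≤-refl

  set-≡ : ∀ (X : Fin n → Bool) v b → set X v b v ≡ b
  set-≡ X v b with v Fin.≟ v
  ... | yes _  = refl
  ... | no v≢v = contradiction refl v≢v

  set-≢ : ∀ (X : Fin n → Bool) v b u → u ≢ v → set X v b u ≡ X u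
  set-≢ X v b u u≢v with u Fin.≟ v
  ... | yes u≡v = contradiction u≡v u≢v
  ... | no  _   = refl

  amortized-same-time : ∀ {F S F′ S′ t c} → sumℕ (debt F S t) ≤ sumℕ (debt F′ S′ t) + c →
    Amortized ⟨ F , S , t ⟩ ⟨ F′ , S′ , t ⟩ c
  amortized-same-time {F′ = F′} {S′} {t} {c} Φ≤ =
    +-monoˡ-≤ (2 * M * openBlocks t) (≤-trans Φ≤ (≤-reflexive (+-comm (sumℕ (debt F′ S′ t)) c)))

  amortized-store : ∀ {F S t} v → F v ≡ true → Amortized ⟨ F , S , t ⟩ ⟨ F , set S v true , t ⟩ 1
  amortized-store {F} {S} {t} v inF = amortized-same-time (sumℕ-≤-update v 1 unchanged changed)
    where
    unchanged : ∀ u → u ≢ v → debt F S t u ≡ debt F (set S v true) t u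
    unchanged u u≢v = cong (λ x → debtAt (crossing block u) (F u) x t u) (sym (set-≢ S v true u u≢v))
    changed : debt F S t v ≤ debt F (set S v true) t v + 1
    changed rewrite set-≡ S v true = debtAt-store (crossing block v) (F v) (S v) t v inF

  amortized-load : ∀ {F S t} v → S v ≡ true → Amortized ⟨ F , S , t ⟩ ⟨ set F v true , S , t ⟩ 1
  amortized-load {F} {S} {t} v inS = amortized-same-time (sumℕ-≤-update v 1 unchanged changed)
    where
    unchanged : ∀ u → u ≢ v → debt F S t u ≡ debt (set F v true) S t u
    unchanged u u≢v = cong (λ x → debtAt (crossing block u) x (S u) t u) (sym (set-≢ F v true u u≢v))
    changed : debt F S t v ≤ debt (set F v true) S t v + 1
    changed rewrite set-≡ F v true = debtAt-load (crossing block v) (F v) (S v) t v inS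

  amortized-evict : ∀ {F S t} v → Amortized ⟨ F , S , t ⟩ ⟨ set F v false , S , t ⟩ 0
  amortized-evict {F} {S} {t} v = amortized-same-time (sumℕ-≤-update v 0 unchanged changed)
    where
    unchanged : ∀ u → u ≢ v → debt F S t u ≡ debt (set F v false) S t u
    unchanged u u≢v = cong (λ x → debtAt (crossing block u) x (S u) t u) (sym (set-≢ F v false u u≢v))
    changed : debt F S t v ≤ debt (set F v false) S t v + 0
    changed rewrite set-≡ F v false | +-identityʳ (debtAt (crossing block v) false (S v) t v) =
      debtAt-evict (crossing block v) (F v) (S v) t v

  openBlocks-⊆ : ∀ t → (λ j → ⌊ suc t <? end j ⌋) ⊆ (λ j → ⌊ t <? end j ⌋)
  openBlocks-⊆ t j t+1<end = ⌊⌋-true⁺ (t <? end j) (<-trans (n<1+n t) (⌊⌋-true⁻ t+1<end))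

  openBlocks-suc-≤ : ∀ t → openBlocks (suc t) ≤ openBlocks t
  openBlocks-suc-≤ t = count-mono-≤ (openBlocks-⊆ t)

  module Compute (F S : Fin n → Bool) (t : ℕ) (t<n : t < n)
    (operands-fast : ∀ w → E w (vertexAt (fromℕ< t<n)) ≡ true → F w ≡ true) where

    v : Fin n
    v = vertexAt (fromℕ< t<n)

    F′ : Fin n → Bool
    F′ = set F v true

    time-v : time v ≡ t
    time-v = trans (cong toℕ (inv₁ (fromℕ< t<n))) (Fin.toℕ-fromℕ< t<n)

    time≡t⇒≡v : ∀ w → time w ≡ t → w ≡ v
    time≡t⇒≡v w tw≡t =
      trans (sym (inv₂ w)) (cong vertexAt (Fin.toℕ-injective (trans tw≡t (sym (Fin.toℕ-fromℕ< t<n)))))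

    stillNeeded-suc : ∀ u → F u ≡ false → stillNeeded t u ≡ true → stillNeeded (suc t) u ≡ true
    stillNeeded-suc u notFast needed with anyFin-elim _ needed
    ... | w , euw∧t≤tw with ∧-true⁻ euw∧t≤tw
    ...   | euw , t≤tw with m≤n⇒m<n∨m≡n (⌊⌋-true⁻ t≤tw)
    ...     | inj₁ t<tw = anyFin-intro _ w (cong₂ _∧_ euw (⌊⌋-true⁺ (suc t ≤? time w) t<tw))
    -- a successor evaluated at time t is v itself, all of whose operands are in fast memory
    ...     | inj₂ t≡tw
      with () ← trans (sym notFast) (operands-fast u (subst (λ x → E u x ≡ true) (time≡t⇒≡v w (sym t≡tw)) euw))

    closing : Fin n → Bool
    closing u = F′ u ∧ ⌊ deadline u ℕ.≟ suc t ⌋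

    debt-at-deadline : ∀ u inSlow → deadline u ≡ suc t → stillNeeded (suc t) u ≡ true →
      restoreCost inSlow ≤
        (if stranded (F′ u) (suc t) u then restoreCost inSlow else 0) + (if closing u then 2 else 0)
    debt-at-deadline u inSlow du≡t+1 needed with F′ u
    ... | true  rewrite ⌊⌋-true⁺ (deadline u ℕ.≟ suc t) du≡t+1 = restoreCost-≤ inSlow
    ... | false rewrite needed = m≤m+n _ _

    debt-after-deadline : ∀ u inSlow →
      (if stranded (F u) t u then restoreCost inSlow else 0) ≤
      (if stranded (F u) (suc t) u then restoreCost inSlow else 0)
    debt-after-deadline u inSlow with F u in inF | stillNeeded t u in needed
    ... | true  | _     = z≤n
    ... | false | false = z≤n
    ... | false | true  rewrite stillNeeded-suc u inF needed = ≤-refl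

    past-deadline⇒≢v : ∀ u → ¬ (t < deadline u) → u ≢ v
    past-deadline⇒≢v u t≮d refl = t≮d (subst (_< deadline v) time-v (before-end v))

    debt-compute : ∀ u → debt F S t u ≤ debt F′ S (suc t) u + (if closing u then 2 else 0)
    debt-compute u with crossing block u in cross
    ... | false = z≤n
    ... | true with t <? deadline u | suc t <? deadline u
    ...   | yes _   | yes _     = m≤m+n _ _
    ...   | no  t≮d | yes t+1<d = contradiction (<-trans (n<1+n t) t+1<d) t≮d
    ...   | yes t<d | no  t+1≮d = debt-at-deadline u (S u) du≡t+1 neededAfter
      where
      du≡t+1 = ≤-antisym (≮⇒≥ t+1≮d) t<d
      neededAfter = subst (λ x → stillNeeded x u ≡ true) du≡t+1 (stillNeeded-deadline u cross)
    ...   | no  t≮d | no  _ rewrite set-≢ F v true u (past-deadline⇒≢v u t≮d) =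
      ≤-trans (debt-after-deadline u (S u)) (m≤m+n _ _)

    openBlocks-closing : ∀ u → deadline u ≡ suc t → openBlocks (suc t) < openBlocks t
    openBlocks-closing u du≡t+1 = count-mono-< (openBlocks-⊆ t) (block u)
      (⌊⌋-false⁺ (suc t <? deadline u) (λ t+1<du → <-irrefl (sym du≡t+1) t+1<du))
      (⌊⌋-true⁺ (t <? deadline u) (≤-reflexive (sym du≡t+1)))

    closing-paid : count F′ ≤ M → count closing * 2 + 2 * M * openBlocks (suc t) ≤ 2 * M * openBlocks t
    closing-paid cap with anyFin closing in anyClosing
    ... | false rewrite count-none (anyFin-false⇒ closing anyClosing) = *-monoʳ-≤ (2 * M) (openBlocks-suc-≤ t)
    ... | true with anyFin-elim closing anyClosing
    ...   | u , closing-u = begin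
      count closing * 2 + 2 * M * openBlocks (suc t)   ≤⟨ +-monoˡ-≤ _ (*-monoˡ-≤ 2 closing-≤ ) ⟩
      M * 2 + 2 * M * openBlocks (suc t)               ≡⟨ cong (_+ 2 * M * openBlocks (suc t)) (*-comm M 2) ⟩
      2 * M + 2 * M * openBlocks (suc t)               ≡⟨ *-suc (2 * M) (openBlocks (suc t)) ⟨
      2 * M * suc (openBlocks (suc t))                 ≤⟨ *-monoʳ-≤ (2 * M) (openBlocks-closing u du≡t+1) ⟩
      2 * M * openBlocks t                             ∎
      where
      open ≤-Reasoning
      closing-≤ : count closing ≤ M
      closing-≤ = ≤-trans (count-mono-≤ {p = closing} {q = F′} (λ w → proj₁ ∘ ∧-true⁻ {F′ w})) cap
      du≡t+1 : deadline u ≡ suc t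
      du≡t+1 = ⌊⌋-true⁻ {d = deadline u ℕ.≟ suc t} (proj₂ (∧-true⁻ {F′ u} closing-u))

    amortized-compute : count F′ ≤ M → Amortized ⟨ F , S , t ⟩ ⟨ F′ , S , suc t ⟩ 0
    amortized-compute cap = begin
      sumℕ (debt F S t) + 2 * M * openBlocks (suc t)
        ≤⟨ +-monoˡ-≤ _ (sumℕ-≤-+-if closing 2 debt-compute) ⟩
      Φ′ + count closing * 2 + 2 * M * openBlocks (suc t)
        ≡⟨ +-assoc Φ′ (count closing * 2) _ ⟩
      Φ′ + (count closing * 2 + 2 * M * openBlocks (suc t))
        ≤⟨ +-monoʳ-≤ Φ′ (closing-paid cap) ⟩
      Φ′ + 2 * M * openBlocks t ∎
      where
      open ≤-Reasoning
      Φ′ = sumℕ (debt F′ S (suc t))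

  amortized-trans : ∀ {s s′ s″ c c′} → Amortized s s′ c → Amortized s′ s″ c′ → Amortized s s″ (c + c′)
  amortized-trans {s} {s′} {s″} {c} {c′} first second =
    +-cancelʳ-≤ Q (Φ s + R) ((c + c′) + Φ s″ + P) (begin
    Φ s + R + Q
      ≡⟨ +-CS.xy∙z≈xz∙y (Φ s) R Q ⟩
    Φ s + Q + R
      ≤⟨ +-monoˡ-≤ R first ⟩
    c + Φ s′ + P + R
      ≡⟨ solve 4 (λ c B P R → c :+ B :+ P :+ R := c :+ P :+ (B :+ R)) refl c (Φ s′) P R ⟩
    c + P + (Φ s′ + R)
      ≤⟨ +-monoʳ-≤ (c + P) second ⟩
    c + P + (c′ + Φ s″ + Q)
      ≡⟨ solve 5 (λ c P c′ D Q → c :+ P :+ (c′ :+ D :+ Q) := c :+ c′ :+ D :+ P :+ Q) refl c P c′ (Φ s″) Q ⟩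
    (c + c′) + Φ s″ + P + Q ∎)
    where
    open ≤-Reasoning
    open +-*-Solver
    P Q R : ℕ
    P = 2 * M * openBlocks (MState.done s)
    Q = 2 * M * openBlocks (MState.done s′)
    R = 2 * M * openBlocks (MState.done s″)

  amortized-step : ∀ {s s′ c} → Step E M σ s s′ c → Amortized s s′ c
  amortized-step (compute {F} {S} t t<n operands-fast cap) = Compute.amortized-compute F S t t<n operands-fast cap
  amortized-step (store v inF)  = amortized-store v inF
  amortized-step (load v inS _) = amortized-load v inS
  amortized-step (evict v)      = amortized-evict v

  amortized-run : ∀ {s s′ c} → Run E M σ s s′ c → Amortized s s′ c
  amortized-run []           = ≤-refl
  amortized-run (first ∷ rest) = amortized-trans (amortized-step first) (amortized-run rest)

  Φ-initial : Φ (initState n) ≡ count (crossing block) * 2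
  Φ-initial = trans (ℕΣ.sum-cong-≗ debt-initial) (sumℕ-if 2 (crossing block))
    where
    debt-initial : ∀ u → debt (λ _ → false) (λ _ → false) 0 u ≡ (if crossing block u then 2 else 0)
    debt-initial u with crossing block u
    ... | false = refl
    ... | true rewrite ⌊⌋-true⁺ (0 <? deadline u) (≤-<-trans z≤n (before-end u)) = refl

  Φ-final : ∀ F S → Φ ⟨ F , S , n ⟩ ≡ 0
  Φ-final F S = trans (ℕΣ.sum-cong-≗ debt-final) (ℕΣ.sum-replicate-zero n)
    where
    notNeeded : ∀ u → stillNeeded n u ≡ false
    notNeeded u = anyFin-false⇐ _ (λ w →
      trans (cong (E u w ∧_) (⌊⌋-false⁺ (n ≤? time w) (<⇒≱ (Fin.toℕ<n (timeOf w))))) (𝔹.∧-zeroʳ (E u w)))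
    debt-final : ∀ u → debt F S n u ≡ 0
    debt-final u with crossing block u
    ... | false = refl
    ... | true rewrite ⌊⌋-false⁺ (n <? deadline u) (≤⇒≯ (end-≤ (block u))) | notNeeded u
      = cong (λ b → if b then restoreCost (S u) else 0) (𝔹.∧-zeroʳ (not (F u)))

  io-lower-bound : ∀ {F S c} → Run E M σ (initState n) ⟨ F , S , n ⟩ c →
    count (crossing block) * 2 ≤ c + 2 * M * k
  io-lower-bound {F} {S} {c} run = begin
    count (crossing block) * 2
      ≡⟨ Φ-initial ⟨
    Φ (initState n)
      ≤⟨ m≤m+n _ _ ⟩
    Φ (initState n) + 2 * M * openBlocks n
      ≤⟨ amortized-run run ⟩
    c + Φ ⟨ F , S , n ⟩ + 2 * M * openBlocks 0
      ≡⟨ cong (λ x → c + x + 2 * M * openBlocks 0) (trans (Φ-final F S) (sym (+-identityʳ 0))) ⟩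
    c + 0 + 2 * M * openBlocks 0
      ≡⟨ cong (_+ 2 * M * openBlocks 0) (+-identityʳ c) ⟩
    c + 2 * M * openBlocks 0
      ≤⟨ +-monoʳ-≤ c (*-monoʳ-≤ (2 * M) (count-≤ _)) ⟩
    c + 2 * M * k ∎
    where open ≤-Reasoning

module ObjectiveBound {n : ℕ} (E : Graph n) (M : ℕ) (σ : TopOrder E) (k′ : ℕ) where

  open Rationals
  open Sums
  open Counting
  open Blocks n k′
  open TopOrder σ
  open CutWeights E using (crossing; cutWeight; cutWeight-≤; ∑-∑-L̃-*-δ)
  open PermutationConjugation using (tr-conjugate)
  open import Data.Empty using (⊥-elim)
  open import Data.Nat using (_≤?_)
  import Data.Nat.Properties as ℕ
  open import Data.Product using (_,_)
  open import Data.Rational using (_+_; _*_; _≤_)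
  open import Data.Rational.Properties using (+-mono-≤; module ≤-Reasoning)
  open import Relation.Binary.PropositionalEquality
  open import Relation.Nullary using (yes; no)

  colour : Fin n → Fin (suc k′)
  colour u = block (timeOf u)

  end : Fin (suc k′) → ℕ
  end j = start (suc (toℕ j))

  crossing-after-end : ∀ u w → E u w ≡ true → colour u ≢ colour w → end (colour u) ℕ.≤ toℕ (timeOf w)
  crossing-after-end u w euw cu≢cw with end (colour u) ≤? toℕ (timeOf w)
  ... | yes end≤tw = end≤tw
  ... | no  end≰tw = ⊥-elim (cu≢cw (sym (block-unique (timeOf w) (colour u) start≤tw (ℕ.≰⇒> end≰tw))))
    where
    start≤tw = ℕ.≤-trans (start-block-≤ (timeOf u)) (ℕ.<⇒≤ (topo u w euw))

  tr-≤-crossings :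
    tr ((((permMat σ ᵀ) ⊗ L̃ E) ⊗ permMat σ) ⊗ W n k′) ≤ ℕ→ℚ (count (crossing colour) ℕ.* 2)
  tr-≤-crossings = begin
    tr ((((permMat σ ᵀ) ⊗ L̃ E) ⊗ permMat σ) ⊗ W n k′)
      ≡⟨ tr-conjugate σ (L̃ E) (W n k′) ⟩
    ∑ (λ i → ∑ (λ l → L̃ E i l * W n k′ (timeOf l) (timeOf i)))
      ≡⟨ ∑-cong (λ i → ∑-cong (λ l → cong (L̃ E i l *_) (sameBlock l i))) ⟩
    ∑ (λ i → ∑ (λ l → L̃ E i l * δ (colour i) (colour l)))
      ≡⟨ ∑-∑-L̃-*-δ colour ⟩
    cutWeight colour + cutWeight colour
      ≤⟨ +-mono-≤ (cutWeight-≤ colour) (cutWeight-≤ colour) ⟩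
    ℕ→ℚ (count (crossing colour)) + ℕ→ℚ (count (crossing colour))
      ≡⟨ ℕ→ℚ-+ (count (crossing colour)) _ ⟨
    ℕ→ℚ (count (crossing colour) ℕ.+ count (crossing colour))
      ≡⟨ cong ℕ→ℚ (m+m≡m*2 (count (crossing colour))) ⟩
    ℕ→ℚ (count (crossing colour) ℕ.* 2) ∎
    where
    open ≤-Reasoning
    sameBlock : ∀ l i → W n k′ (timeOf l) (timeOf i) ≡ δ (colour i) (colour l)
    sameBlock l i = trans (W≡δ (timeOf l) (timeOf i)) (δ-sym (colour l) (colour i))
    m+m≡m*2 : ∀ m → m ℕ.+ m ≡ m ℕ.* 2
    m+m≡m*2 m = trans (cong (m ℕ.+_) (sym (ℕ.+-identityʳ m))) (ℕ.*-comm 2 m)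

  objective-≤-io : ∀ {c} → Evaluation E M σ c → objective E M σ k′ ≤ ℕ→ℚ c
  objective-≤-io {c} (_ , _ , run) = ≤-+⇒-≤ (begin
    tr ((((permMat σ ᵀ) ⊗ L̃ E) ⊗ permMat σ) ⊗ W n k′)   ≤⟨ tr-≤-crossings ⟩
    ℕ→ℚ (count (crossing colour) ℕ.* 2)                 ≤⟨ ℕ→ℚ-mono-≤ io-bound ⟩
    ℕ→ℚ (c ℕ.+ 2 ℕ.* M ℕ.* suc k′)                      ≡⟨ cong (λ x → ℕ→ℚ (c ℕ.+ x)) swap-M-k ⟩
    ℕ→ℚ (c ℕ.+ 2 ℕ.* suc k′ ℕ.* M)                      ≡⟨ ℕ→ℚ-+ c (2 ℕ.* suc k′ ℕ.* M) ⟩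
    ℕ→ℚ c + ℕ→ℚ (2 ℕ.* suc k′ ℕ.* M)                    ∎)
    where
    open ≤-Reasoning
    io-bound = IOLowerBound.io-lower-bound E M σ colour end
                 (λ u → <-end-block (timeOf u)) end-≤ crossing-after-end run
    swap-M-k : 2 ℕ.* M ℕ.* suc k′ ≡ 2 ℕ.* suc k′ ℕ.* M
    swap-M-k =
      trans (ℕ.*-assoc 2 M (suc k′)) (trans (cong (2 ℕ.*_) (ℕ.*-comm M (suc k′))) (sym (ℕ.*-assoc 2 (suc k′) M)))

open Rationals using (maxUpTo; maxUpTo-upper; maxUpTo-attained; maxUpTo-least)
open import Data.Product using (_,_)
open import Data.Rational using (ℚ; _≤_)
import Data.Rational.Properties as ℚ

maxUpTo-objective-isMax : ∀ {n′} (E : Graph (suc n′)) M (σ : TopOrder E) →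
  IsMaxObj E M σ (maxUpTo (objective E M σ) n′)
maxUpTo-objective-isMax {n′} E M σ with maxUpTo-attained (objective E M σ) n′
... | k , k≤n′ , attains =
  (k , ℕ.s≤s k≤n′ , attains) , λ k′ k′<n → maxUpTo-upper (objective E M σ) (ℕ.≤-pred k′<n)

theorem4p3 : (n M : ℕ) (E : Graph n) → Acyclic E →
    (j : ℕ) (v : ℚ) → IsOptimalIO E M j → IsMinMax E M v →
    v ≤ ℕ→ℚ j
theorem4p3 zero     M E _ j v _ ((_ , (_ , () , _) , _) , _)
theorem4p3 (suc n′) M E _ j v ((σ , evaluation) , _) (_ , minimal) =
  ℚ.≤-trans (minimal σ _ (maxUpTo-objective-isMax E M σ))
            (maxUpTo-least (objective E M σ) {K = n′} objective-≤-j)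
  where
  objective-≤-j : ∀ k′ → k′ ℕ.≤ n′ → objective E M σ k′ ≤ ℕ→ℚ j
  objective-≤-j k′ _ = ObjectiveBound.objective-≤-io E M σ k′ evaluation
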